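{- Let $A = \{a_1 < a_2 < \dots\}$ and $B = \{b_1 < b_2 < \dots\}$ be infinite strictly increasing sequences of positive integers with $b_1 > 1$ such that $P(A) = \mathbb{N} \setminus B$. Suppose that for some $k \geq 1$ we have $P(\{a_1, \dots, a_k\}) = [0, b_1 - 1]$, and suppose $b_2 \geq 2b_1 + 2$. Then $a_{k+1} = b_1 + 1$, $a_{k+2} \leq 2b_1 + 1$, and $$P(\{a_1, \dots, a_{k+1}\}) = [0, 2b_1] \setminus \{b_1\},$$ $$P(\{a_1, \dots, a_{k+2}\}) = [0, a_{k+2} + 2b_1] \setminus \{b_1, a_{k+2} + b_1\}.$$
   Context: $\mathbb{N}$ denotes the set of all nonnegative integers, and for integers $x \le y$, $[x, y]$ denotes the set of integers $n$ with $x \leq n \leq y$. For a set $A$ of positive integers, $P(A) = \{\sum \varepsilon_i a_i : a_i \in A, \varepsilon_i \in \{0,1\}, \sum \varepsilon_i < \infty\}$ is the set of all finite subset sums of $A$; in particular $0 \in P(A)$ (empty sum). -}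

module Defs where

open import Data.Nat using (ℕ; zero; suc; _+_; _<_)
open import Data.Product using (∃)
open import Relation.Binary.PropositionalEquality using (_≡_)

-- Sequences are 0-indexed: a i stands for the paper's a_{i+1}.
StrictlyIncreasing : (ℕ → ℕ) → Set
StrictlyIncreasing a = ∀ i → a i < a (suc i)

-- PS a k n : n is a (finite) subset sum of {a 0, …, a (k-1)},
-- i.e. n ∈ P({a_1,…,a_k}).  Each of the first k terms is either
-- omitted or used exactly once.
data PS (a : ℕ → ℕ) : ℕ → ℕ → Set where
  empty : PS a zero zero
  skip  : ∀ {k n} → PS a k n → PS a (suc k) n
  take  : ∀ {k n} → PS a k n → PS a (suc k) (n + a k)

-- n ∈ P(A) for A = {a 0, a 1, …}: every finite subset lies in some prefix.
P : (ℕ → ℕ) → ℕ → Set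
P a n = ∃ λ k → PS a k n

InSeq : (ℕ → ℕ) → ℕ → Set
InSeq b n = ∃ λ i → b i ≡ n

{-# OPTIONS --safe #-}
module Submission where

-- Every element of P(A) outside P({a_1,…,a_k}) is at least a_{k+1}, and since
-- b_2 ≥ 2b_1 + 2 every integer in (b_1, 2b_1 + 1] lies in P(A).  Applied to b_1 + 1
-- this gives a_{k+1} ≤ b_1 + 1, while a_{k+1} ≤ b_1 would put
-- b_1 = (b_1 − a_{k+1}) + a_{k+1} into P(A).  Adjoining a term x to a prefix turns
-- its set S of subset sums into S ∪ (x + S); two such steps starting from
-- [0, b_1 − 1] produce the two sets, and a_{k+2} ≤ 2b_1 + 1 because 2b_1 + 1 ∈ P(A)
-- is not a subset sum of the first k + 1 terms.

open import Defs
open import Data.Nat using (ℕ; zero; suc; _+_; _*_; _∸_; _≤_; _<_; z≤n; s≤s; z<s; _≤?_; _<?_)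
open import Data.Nat.Properties
open import Data.Product using (_×_; _,_; proj₁)
open import Data.Sum using (_⊎_; inj₁; inj₂)
open import Relation.Binary.PropositionalEquality
  using (_≡_; _≢_; refl; sym; trans; subst; cong)
open import Relation.Nullary using (¬_; yes; no; contradiction)
open import Function using (_∘_)
open import Function.Bundles using (_⇔_; Equivalence; mk⇔)
open import Function.Properties.Equivalence using () renaming (refl to ⇔-refl; trans to ⇔-trans)
open import Data.Sum.Function.Propositional using (_⊎-⇔_)
open import Data.Product.Function.NonDependent.Propositional using (_×-⇔_)

open Equivalence

module _ {a : ℕ → ℕ} where

  StrictlyIncreasing⇒monotone : StrictlyIncreasing a → ∀ {i j} → i ≤ j → a i ≤ a j
  StrictlyIncreasing⇒monotone inc i≤j with m≤n⇒m<n∨m≡n i≤j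
  ... | inj₂ refl       = ≤-refl
  ... | inj₁ (s≤s i≤j′) = ≤-trans (StrictlyIncreasing⇒monotone inc i≤j′) (<⇒≤ (inc _))

  PS-weaken : ∀ {m k n} → m ≤ k → PS a m n → PS a k n
  PS-weaken m≤k p with m≤n⇒m<n∨m≡n m≤k
  ... | inj₂ refl       = p
  ... | inj₁ (s≤s m≤k′) = skip (PS-weaken m≤k′ p)

  PS-suc : ∀ {k n} → PS a (suc k) n ⇔ (PS a k n ⊎ (a k ≤ n × PS a k (n ∸ a k)))
  PS-suc {k} = mk⇔ to′ from′
    where
    to′ : ∀ {n} → PS a (suc k) n → PS a k n ⊎ (a k ≤ n × PS a k (n ∸ a k))
    to′ (skip p)         = inj₁ p
    to′ (take {n = m} p) = inj₂ (m≤n+m (a k) m , subst (PS a k) (sym (m+n∸n≡m m (a k))) p)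

    from′ : ∀ {n} → PS a k n ⊎ (a k ≤ n × PS a k (n ∸ a k)) → PS a (suc k) n
    from′ (inj₁ p)          = skip p
    from′ (inj₂ (ak≤n , p)) = subst (PS a (suc k)) (m∸n+n≡m ak≤n) (take p)

  PS-suc-cong : ∀ {k} {S : ℕ → Set} → (∀ n → PS a k n ⇔ S n) →
                ∀ n → PS a (suc k) n ⇔ (S n ⊎ (a k ≤ n × S (n ∸ a k)))
  PS-suc-cong {k} PS⇔S n = ⇔-trans PS-suc (PS⇔S n ⊎-⇔ (⇔-refl ×-⇔ PS⇔S (n ∸ a k)))

  PS-prefix⊎summand≤ : StrictlyIncreasing a → ∀ {m n} → PS a m n → ∀ k → PS a k n ⊎ a k ≤ n
  PS-prefix⊎summand≤ inc empty    k = inj₁ (PS-weaken z≤n empty)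
  PS-prefix⊎summand≤ inc (skip p) k = PS-prefix⊎summand≤ inc p k
  PS-prefix⊎summand≤ inc (take {m} {n} p) k with k ≤? m
  ... | yes k≤m = inj₂ (≤-trans (StrictlyIncreasing⇒monotone inc k≤m) (m≤n+m (a m) n))
  ... | no  k≰m = inj₁ (PS-weaken (≰⇒> k≰m) (take p))

  P∖PS⇒summand≤ : StrictlyIncreasing a → ∀ {k n} → P a n → ¬ PS a k n → a k ≤ n
  P∖PS⇒summand≤ inc {k} (_ , p) p∉PSk with PS-prefix⊎summand≤ inc p k
  ... | inj₁ p∈PSk = contradiction p∈PSk p∉PSk
  ... | inj₂ ak≤n  = ak≤n

2*n≡n+n : ∀ n → 2 * n ≡ n + n
2*n≡n+n n = cong (n +_) (+-identityʳ n)

[0,B-1]∪[B+1,2B]⇔[0,2B]∖B : ∀ {B x n} → x ≡ B + 1 →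
  (n < B ⊎ (x ≤ n × n ∸ x < B)) ⇔ (n ≤ 2 * B × n ≢ B)
[0,B-1]∪[B+1,2B]⇔[0,2B]∖B {B} {n = n} refl = mk⇔ to′ from′
  where
  open ≤-Reasoning

  to′ : n < B ⊎ (B + 1 ≤ n × n ∸ (B + 1) < B) → n ≤ 2 * B × n ≢ B
  to′ (inj₁ n<B) = ≤-trans (<⇒≤ n<B) (m≤m+n B (B + 0)) , <⇒≢ n<B
  to′ (inj₂ (B+1≤n , lt)) = n≤2B , >⇒≢ (subst (_≤ n) (+-comm B 1) B+1≤n)
    where
    n≤2B : n ≤ 2 * B
    n≤2B = begin
      n                           ≡⟨ sym (m∸n+n≡m B+1≤n) ⟩
      n ∸ (B + 1) + (B + 1)       ≡⟨ cong (n ∸ (B + 1) +_) (+-comm B 1) ⟩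
      n ∸ (B + 1) + suc B         ≡⟨ +-suc (n ∸ (B + 1)) B ⟩
      suc (n ∸ (B + 1)) + B       ≤⟨ +-monoˡ-≤ B lt ⟩
      B + B                       ≡⟨ 2*n≡n+n B ⟨
      2 * B                       ∎

  from′ : n ≤ 2 * B × n ≢ B → n < B ⊎ (B + 1 ≤ n × n ∸ (B + 1) < B)
  from′ (n≤2B , n≢B) with n <? B
  ... | yes n<B = inj₁ n<B
  ... | no  n≮B = inj₂ (B+1≤n , n∸[B+1]<B)
    where
    B+1≤n : B + 1 ≤ n
    B+1≤n = subst (_≤ n) (+-comm 1 B) (≤∧≢⇒< (≮⇒≥ n≮B) (n≢B ∘ sym))

    n<B+1+B : n < B + 1 + B
    n<B+1+B = subst (n <_) (cong (_+ B) (+-comm 1 B)) (s≤s (subst (n ≤_) (2*n≡n+n B) n≤2B))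

    n∸[B+1]<B : n ∸ (B + 1) < B
    n∸[B+1]<B = subst (n ∸ (B + 1) <_) (m+n∸m≡n (B + 1) B) (∸-monoˡ-< n<B+1+B B+1≤n)

[0,2B]∖B∪c+[0,2B]∖B⇔[0,c+2B]∖B,c+B : ∀ {B c n} → B < c → c ≤ 2 * B + 1 →
  ((n ≤ 2 * B × n ≢ B) ⊎ (c ≤ n × (n ∸ c ≤ 2 * B × n ∸ c ≢ B))) ⇔
  (n ≤ c + 2 * B × n ≢ B × n ≢ c + B)
[0,2B]∖B∪c+[0,2B]∖B⇔[0,c+2B]∖B,c+B {B} {c} {n} B<c c≤2B+1 = mk⇔ to′ from′
  where
  open ≤-Reasoning

  2B<c+B : 2 * B < c + B
  2B<c+B = subst (_< c + B) (sym (2*n≡n+n B)) (+-monoˡ-< B B<c)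

  to′ : (n ≤ 2 * B × n ≢ B) ⊎ (c ≤ n × (n ∸ c ≤ 2 * B × n ∸ c ≢ B)) →
        n ≤ c + 2 * B × n ≢ B × n ≢ c + B
  to′ (inj₁ (n≤2B , n≢B)) =
    m≤n⇒m≤o+n c n≤2B , n≢B , λ n≡c+B → <⇒≱ 2B<c+B (subst (_≤ 2 * B) n≡c+B n≤2B)
  to′ (inj₂ (c≤n , n∸c≤2B , n∸c≢B)) = n≤c+2B , >⇒≢ (<-≤-trans B<c c≤n) ,
                                       λ n≡c+B → n∸c≢B (trans (cong (_∸ c) n≡c+B) (m+n∸m≡n c B))
    where
    n≤c+2B : n ≤ c + 2 * B
    n≤c+2B = begin
      n              ≡⟨ sym (m∸n+n≡m c≤n) ⟩
      n ∸ c + c      ≤⟨ +-monoˡ-≤ c n∸c≤2B ⟩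
      2 * B + c      ≡⟨ +-comm (2 * B) c ⟩
      c + 2 * B      ∎

  from′ : n ≤ c + 2 * B × n ≢ B × n ≢ c + B →
          (n ≤ 2 * B × n ≢ B) ⊎ (c ≤ n × (n ∸ c ≤ 2 * B × n ∸ c ≢ B))
  from′ (n≤c+2B , n≢B , n≢c+B) with n ≤? 2 * B
  ... | yes n≤2B = inj₁ (n≤2B , n≢B)
  ... | no  n≰2B = inj₂ (c≤n , m≤n+o⇒m∸n≤o n c n≤c+2B , n∸c≢B)
    where
    c≤n : c ≤ n
    c≤n = ≤-trans c≤2B+1 (subst (_≤ n) (+-comm 1 (2 * B)) (≰⇒> n≰2B))

    n∸c≢B : n ∸ c ≢ B
    n∸c≢B n∸c≡B = n≢c+B (begin-equality
      n          ≡⟨ sym (m∸n+n≡m c≤n) ⟩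
      n ∸ c + c  ≡⟨ cong (_+ c) n∸c≡B ⟩
      B + c      ≡⟨ +-comm B c ⟩
      c + B      ∎)

lemma2p1 : (a b : ℕ → ℕ) → StrictlyIncreasing a → 1 ≤ a 0 →
    StrictlyIncreasing b → 1 < b 0 →
    (∀ n → P a n ⇔ (¬ InSeq b n)) →
    (k : ℕ) → 1 ≤ k →
    (∀ n → PS a k n ⇔ (n < b 0)) →
    2 * b 0 + 2 ≤ b 1 →
    (a k ≡ b 0 + 1)
    × (a (suc k) ≤ 2 * b 0 + 1)
    × (∀ n → PS a (suc k) n ⇔ (n ≤ 2 * b 0 × n ≢ b 0))
    × (∀ n → PS a (suc (suc k)) n ⇔ (n ≤ a (suc k) + 2 * b 0 × n ≢ b 0 × n ≢ a (suc k) + b 0))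
lemma2p1 a b incA 1≤a0 incB _ P⇔∉b k _ PSk⇔<B 2B+2≤b1 =
  ak≡B+1 , a[k+1]≤2B+1 , PS[k+1]⇔ , PS[k+2]⇔
  where
  B = b 0

  B∉P : ¬ P a B
  B∉P p = to (P⇔∉b B) p (0 , refl)

  B<n<b1⇒P : ∀ {n} → B < n → n < b 1 → P a n
  B<n<b1⇒P B<n n<b1 = from (P⇔∉b _) λ where
    (zero  , b0≡n) → <-irrefl b0≡n B<n
    (suc i , bi≡n) → <⇒≱ n<b1 (subst (b 1 ≤_) bi≡n (StrictlyIncreasing⇒monotone incB (s≤s z≤n)))

  B+1≤2B+1 : B + 1 ≤ 2 * B + 1
  B+1≤2B+1 = +-monoˡ-≤ 1 (m≤m+n B (B + 0))

  2B+1<b1 : 2 * B + 1 < b 1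
  2B+1<b1 = subst (_≤ b 1) (+-suc (2 * B) 1) 2B+2≤b1

  B<ak : B < a k
  B<ak with B <? a k
  ... | yes B<ak = B<ak
  ... | no  B≮ak = contradiction (suc k , from (PS-suc-cong PSk⇔<B B) (inj₂ (ak≤B , B∸ak<B))) B∉P
    where
    ak≤B : a k ≤ B
    ak≤B = ≮⇒≥ B≮ak

    B∸ak<B : B ∸ a k < B
    B∸ak<B = ∸-monoʳ-< (≤-trans 1≤a0 (StrictlyIncreasing⇒monotone incA z≤n)) ak≤B

  ak≤B+1 : a k ≤ B + 1
  ak≤B+1 = P∖PS⇒summand≤ incA (B<n<b1⇒P (m<m+n B z<s) (≤-<-trans B+1≤2B+1 2B+1<b1))
             λ p → <⇒≱ (to (PSk⇔<B (B + 1)) p) (m≤m+n B 1)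

  ak≡B+1 : a k ≡ B + 1
  ak≡B+1 = ≤-antisym ak≤B+1 (subst (_≤ a k) (+-comm 1 B) B<ak)

  PS[k+1]⇔ : ∀ n → PS a (suc k) n ⇔ (n ≤ 2 * B × n ≢ B)
  PS[k+1]⇔ n = ⇔-trans (PS-suc-cong PSk⇔<B n) ([0,B-1]∪[B+1,2B]⇔[0,2B]∖B ak≡B+1)

  a[k+1]≤2B+1 : a (suc k) ≤ 2 * B + 1
  a[k+1]≤2B+1 = P∖PS⇒summand≤ incA (B<n<b1⇒P (<-≤-trans (m<m+n B z<s) B+1≤2B+1) 2B+1<b1)
                  λ p → <⇒≱ (m<m+n (2 * B) z<s) (proj₁ (to (PS[k+1]⇔ _) p))

  PS[k+2]⇔ : ∀ n → PS a (suc (suc k)) n ⇔ (n ≤ a (suc k) + 2 * B × n ≢ B × n ≢ a (suc k) + B)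
  PS[k+2]⇔ n = ⇔-trans (PS-suc-cong PS[k+1]⇔ n)
                        ([0,2B]∖B∪c+[0,2B]∖B⇔[0,c+2B]∖B,c+B (<-trans B<ak (incA k)) a[k+1]≤2B+1)
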